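{- Let $n \ge 2$ and let $G$ be a connected multigraph (loopless, parallel edges allowed) on $n$ vertices whose edges are colored with $n-1$ colors so that each color class is a spanning star of $G$, and suppose the $n-1$ monochromatic stars have pairwise distinct centers. Then Stars-to-Stars holds for $G$: the edge set of $G$ contains $n-1$ pairwise edge-disjoint rainbow spanning stars.
   Context: A star is a set of edges forming a tree in which one vertex (the center) is incident to every edge; it is spanning if every vertex of $G$ is incident to one of its edges (equivalently it has $n-1$ edges). A subgraph is monochromatic if all its edges have the same color and rainbow if all its edges have distinct colors. Parallel edges are distinct edges (possibly of different colors). -}

module Defs where

open import Data.Nat using (ℕ)
open import Data.Fin using (Fin)
open import Data.Fin.Subset using (Subset; _∈_)
open import Data.Product using (Σ; _×_; _,_; proj₁; proj₂; ∃-syntax)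
open import Data.Sum using (_⊎_)
open import Relation.Binary.PropositionalEquality using (_≡_; _≢_)
open import Relation.Unary using (Pred)
open import Level using (0ℓ)

-- A loopless multigraph on vertex set Fin n with m edges (edges are the
-- indices Fin m, so parallel edges are distinct edges).
record Multigraph (n m : ℕ) : Set where
  field
    ends     : Fin m → Fin n × Fin n
    loopless : ∀ e → proj₁ (ends e) ≢ proj₂ (ends e)
open Multigraph public

module _ {n m : ℕ} (G : Multigraph n m) where

  Incident : Fin n → Fin m → Set
  Incident v e = proj₁ (ends G e) ≡ v ⊎ proj₂ (ends G e) ≡ v

  Joins : Fin n → Fin n → Fin m → Set
  Joins u v e = (proj₁ (ends G e) ≡ u × proj₂ (ends G e) ≡ v)
              ⊎ (proj₁ (ends G e) ≡ v × proj₂ (ends G e) ≡ u)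

  data Reach : Fin n → Fin n → Set where
    here : ∀ {u} → Reach u u
    step : ∀ {u v w} (e : Fin m) → Joins u v e → Reach v w → Reach u w

  Connected : Set
  Connected = ∀ u v → Reach u v

  -- S (a set of edges) is a spanning star with center c: every edge of S is
  -- incident to c, and every vertex v ≠ c is joined to c by exactly one edge of S.
  -- (Since G is loopless this is exactly a tree in which c meets every edge,
  -- covering all vertices.)
  IsSpanningStar : Pred (Fin m) 0ℓ → Fin n → Set
  IsSpanningStar S c =
      (∀ e → S e → Incident c e)
    × (∀ v → v ≢ c →
         Σ (Fin m) λ e → (S e × Joins c v e)
                       × (∀ e′ → S e′ → Joins c v e′ → e′ ≡ e))

  SpanningStar : Pred (Fin m) 0ℓ → Set
  SpanningStar S = ∃[ c ] IsSpanningStar S c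

  Rainbow : {k : ℕ} → (Fin m → Fin k) → Pred (Fin m) 0ℓ → Set
  Rainbow col S = ∀ e e′ → S e → S e′ → col e ≡ col e′ → e ≡ e′

{-# OPTIONS --safe #-}
-- The i-th rainbow star is centred at the centre cᵢ of the i-th colour class.
-- To every other centre cⱼ it uses the edge of colour j (which lies in the
-- monochromatic star at cⱼ), and to the unique vertex w that is not a centre
-- it uses the edge of colour i.  Two of its edges of the same colour would have
-- to end at the same vertex, so it is rainbow; an edge in the i-th and the j-th
-- rainbow stars joins cᵢ and cⱼ and would have to have both colour j and colour i.
module Submission where

open import Defs
open import Data.Nat using (ℕ; _≥_; _∸_; suc; zero)
open import Data.Nat.Properties using (1+n≰n)
open import Data.Fin as Fin using (Fin; punchOut)
open import Data.Fin.Properties using (_≟_; any?; injective⇒≤; punchOut-injective)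
open import Data.Fin.Subset using (Subset; _∈_; _∉_)
open import Data.Product using (Σ; ∃; _×_; _,_; proj₁; proj₂)
open import Data.Sum using (_⊎_; inj₁; inj₂)
open import Data.Vec using (tabulate)
open import Data.Vec.Properties using ([]=⇒lookup; lookup⇒[]=; lookup∘tabulate)
open import Function using (_∘_)
open import Function.Definitions using (Injective)
open import Relation.Nullary using (yes; no; does; ¬_; contradiction)
open import Relation.Nullary.Decidable using (dec-true; _×-dec_; _⊎-dec_)
open import Relation.Unary using (Pred; Decidable)
open import Relation.Binary.PropositionalEquality
  using (_≡_; _≢_; refl; sym; trans; cong; subst)

toSubset : ∀ {m p} {P : Pred (Fin m) p} → Decidable P → Subset m
toSubset P? = tabulate (does ∘ P?)

module _ {m p} {P : Pred (Fin m) p} (P? : Decidable P) where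

  ∈-toSubset⁺ : ∀ {x} → P x → x ∈ toSubset P?
  ∈-toSubset⁺ {x} px = lookup⇒[]= x _ (trans (lookup∘tabulate (does ∘ P?) x) (dec-true (P? x) px))

  ∈-toSubset⁻ : ∀ {x} → x ∈ toSubset P? → P x
  ∈-toSubset⁻ {x} x∈ with P? x | trans (sym (lookup∘tabulate (does ∘ P?) x)) ([]=⇒lookup x∈)
  ... | yes px | _ = px
  ... | no _   | ()

injective-misses-at-most-one : ∀ {n} {f : Fin n → Fin (suc n)} → Injective _≡_ _≡_ f →
                               ∀ {u w} → (∀ i → f i ≢ u) → (∀ i → f i ≢ w) → u ≡ w
injective-misses-at-most-one {zero}  _ {Fin.zero} {Fin.zero} _ _ = refl
injective-misses-at-most-one {suc n} {f} f-inj {u} {w} u∉ w∉ with u ≟ w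
... | yes u≡w = u≡w
... | no u≢w = contradiction (injective⇒≤ g-injective) 1+n≰n
  where
  u≢f : ∀ i → u ≢ f i
  u≢f i = u∉ i ∘ sym

  f′ : Fin (suc n) → Fin (suc n)
  f′ i = punchOut (u≢f i)

  w′≢f′ : ∀ i → punchOut u≢w ≢ f′ i
  w′≢f′ i = w∉ i ∘ sym ∘ punchOut-injective u≢w (u≢f i)

  g : Fin (suc n) → Fin n
  g i = punchOut (w′≢f′ i)

  g-injective : Injective _≡_ _≡_ g
  g-injective = f-inj ∘ punchOut-injective (u≢f _) (u≢f _) ∘ punchOut-injective (w′≢f′ _) (w′≢f′ _)

module _ {n m} (G : Multigraph n m) where

  Joins-sym : ∀ {x y e} → Joins G x y e → Joins G y x e
  Joins-sym (inj₁ xy) = inj₂ xy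
  Joins-sym (inj₂ yx) = inj₁ yx

  Joins⇒Incident : ∀ {x y e} → Joins G x y e → Incident G x e
  Joins⇒Incident (inj₁ (p , _)) = inj₁ p
  Joins⇒Incident (inj₂ (_ , q)) = inj₂ q

  Joins⇒≢ : ∀ {x y e} → Joins G x y e → x ≢ y
  Joins⇒≢ {e = e} (inj₁ (refl , refl)) = loopless G e
  Joins⇒≢ {e = e} (inj₂ (refl , refl)) = loopless G e ∘ sym

  Joins-functional : ∀ {x y z e} → Joins G x y e → Joins G x z e → y ≡ z
  Joins-functional (inj₁ (refl , refl)) (inj₁ (_ , q)) = q
  Joins-functional (inj₁ (refl , refl)) (inj₂ (p , q)) = trans q p
  Joins-functional (inj₂ (refl , refl)) (inj₁ (p , q)) = trans p q
  Joins-functional (inj₂ (refl , refl)) (inj₂ (p , _)) = p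

  Incident-Joins : ∀ {x y z e} → Incident G z e → Joins G x y e → z ≡ x ⊎ z ≡ y
  Incident-Joins (inj₁ refl) (inj₁ (p , _)) = inj₁ p
  Incident-Joins (inj₁ refl) (inj₂ (p , _)) = inj₂ p
  Incident-Joins (inj₂ refl) (inj₁ (_ , q)) = inj₂ q
  Incident-Joins (inj₂ refl) (inj₂ (_ , q)) = inj₁ q

  Joins? : ∀ x y → Decidable (Joins G x y)
  Joins? x y e = (proj₁ (ends G e) ≟ x ×-dec proj₂ (ends G e) ≟ y)
           ⊎-dec (proj₁ (ends G e) ≟ y ×-dec proj₂ (ends G e) ≟ x)

module StarColouring {c m} (G : Multigraph (suc c) m) (col : Fin m → Fin c)
                     (center : Fin c → Fin (suc c))
                     (center-injective : Injective _≡_ _≡_ center)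
                     (stars : ∀ j → IsSpanningStar G (λ e → col e ≡ j) (center j)) where

  Vertex : Set
  Vertex = Fin (suc c)

  IsCenter : Vertex → Set
  IsCenter v = ∃ λ j → center j ≡ v

  isCenter? : Decidable IsCenter
  isCenter? v = any? (λ j → center j ≟ v)

  noncenter-unique : ∀ {u w} → ¬ IsCenter u → ¬ IsCenter w → u ≡ w
  noncenter-unique ¬u ¬w =
    injective-misses-at-most-one center-injective (λ j → ¬u ∘ (j ,_)) (λ j → ¬w ∘ (j ,_))

  star-edge-unique : ∀ {j v e e′} → col e ≡ j → col e′ ≡ j →
                     Joins G (center j) v e → Joins G (center j) v e′ → e ≡ e′
  star-edge-unique {j} {v} {e} {e′} cj cj′ jv jv′ = trans (unique e cj jv) (sym (unique e′ cj′ jv′))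
    where unique = proj₂ (proj₂ (proj₂ (stars j) v (Joins⇒≢ G jv ∘ sym)))

  monochromatic-parallel⇒≡ : ∀ {x y e e′} → col e ≡ col e′ →
                             Joins G x y e → Joins G x y e′ → e ≡ e′
  monochromatic-parallel⇒≡ {e = e} same xy xy′
    with Incident-Joins G (proj₁ (stars (col e)) e refl) xy
  ... | inj₁ refl = star-edge-unique refl (sym same) xy xy′
  ... | inj₂ refl = star-edge-unique refl (sym same) (Joins-sym G xy) (Joins-sym G xy′)

  -- the colour of the edge of the i-th rainbow star that joins its centre to v
  owner : Fin c → Vertex → Fin c
  owner i v with isCenter? v
  ... | yes (j , _) = j
  ... | no _        = i

  owner-center : ∀ i j → owner i (center j) ≡ j
  owner-center i j with isCenter? (center j)
  ... | yes (_ , eq)  = center-injective eq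
  ... | no ¬isCenter = contradiction (j , refl) ¬isCenter

  owner-injective : ∀ i {v v′} → v ≢ center i → v′ ≢ center i → owner i v ≡ owner i v′ → v ≡ v′
  owner-injective i {v} {v′} v≢cᵢ v′≢cᵢ same with isCenter? v | isCenter? v′
  ... | yes (_ , refl) | yes (_ , refl) = cong center same
  ... | yes (_ , refl) | no _           = contradiction (cong center same) v≢cᵢ
  ... | no _           | yes (_ , refl) = contradiction (cong center (sym same)) v′≢cᵢ
  ... | no ¬isCenter   | no ¬isCenter′  = noncenter-unique ¬isCenter ¬isCenter′

  InRainbowStar : Fin c → Fin m → Set
  InRainbowStar i e = ∃ λ v → Joins G (center i) v e × col e ≡ owner i v

  inRainbowStar? : ∀ i → Decidable (InRainbowStar i)
  inRainbowStar? i e = any? λ v → Joins? G (center i) v e ×-dec col e ≟ owner i v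

  rainbowStar : Fin c → Subset m
  rainbowStar i = toSubset (inRainbowStar? i)

  rainbowStar-edge : ∀ i {v} → v ≢ center i → ∃ λ e → Joins G (center i) v e × col e ≡ owner i v
  rainbowStar-edge i {v} v≢cᵢ with isCenter? v
  ... | yes (j , refl) =
    let (e , (colour-j , joins) , _) = proj₂ (stars j) (center i) (v≢cᵢ ∘ sym)
    in e , Joins-sym G joins , colour-j
  ... | no _ =
    let (e , (colour-i , joins) , _) = proj₂ (stars i) v v≢cᵢ
    in e , joins , colour-i

  rainbowStar-colour : ∀ {i v e} → e ∈ rainbowStar i → Joins G (center i) v e → col e ≡ owner i v
  rainbowStar-colour e∈ joins with ∈-toSubset⁻ (inRainbowStar? _) e∈
  ... | _ , joins′ , colour = trans colour (cong (owner _) (Joins-functional G joins′ joins))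

  rainbowStar-isSpanningStar : ∀ i → IsSpanningStar G (_∈ rainbowStar i) (center i)
  rainbowStar-isSpanningStar i = incident , spanning
    where
    incident : ∀ e → e ∈ rainbowStar i → Incident G (center i) e
    incident e e∈ = Joins⇒Incident G (proj₁ (proj₂ (∈-toSubset⁻ (inRainbowStar? i) e∈)))

    spanning : ∀ v → v ≢ center i →
               Σ (Fin m) λ e → (e ∈ rainbowStar i × Joins G (center i) v e)
                             × (∀ e′ → e′ ∈ rainbowStar i → Joins G (center i) v e′ → e′ ≡ e)
    spanning v v≢cᵢ =
      let (e , joins , colour) = rainbowStar-edge i v≢cᵢ
      in e , (∈-toSubset⁺ (inRainbowStar? i) (v , joins , colour) , joins)
           , λ e′ e′∈ joins′ →
               monochromatic-parallel⇒≡ (trans (rainbowStar-colour e′∈ joins′) (sym colour)) joins′ joins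

  rainbowStar-rainbow : ∀ i → Rainbow G col (_∈ rainbowStar i)
  rainbowStar-rainbow i e e′ e∈ e′∈ same
    with ∈-toSubset⁻ (inRainbowStar? i) e∈ | ∈-toSubset⁻ (inRainbowStar? i) e′∈
  ... | _ , joins , colour | _ , joins′ , colour′
    with owner-injective i (Joins⇒≢ G joins ∘ sym) (Joins⇒≢ G joins′ ∘ sym)
                           (trans (sym colour) (trans same colour′))
  ...   | refl = monochromatic-parallel⇒≡ same joins joins′

  shared-edge-colour : ∀ {i j e} → i ≢ j → e ∈ rainbowStar i → e ∈ rainbowStar j → col e ≡ j
  shared-edge-colour {i} {j} i≢j e∈ᵢ e∈ⱼ
    with ∈-toSubset⁻ (inRainbowStar? i) e∈ᵢ | ∈-toSubset⁻ (inRainbowStar? j) e∈ⱼ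
  ... | v , joinsᵢ , colour | _ , joinsⱼ , _ with Incident-Joins G (Joins⇒Incident G joinsⱼ) joinsᵢ
  ...   | inj₁ cⱼ≡cᵢ = contradiction (center-injective (sym cⱼ≡cᵢ)) i≢j
  ...   | inj₂ refl  = trans colour (owner-center i j)

  rainbowStars-disjoint : ∀ i j → i ≢ j → ∀ e → e ∈ rainbowStar i → e ∉ rainbowStar j
  rainbowStars-disjoint i j i≢j e e∈ᵢ e∈ⱼ =
    i≢j (trans (sym (shared-edge-colour (i≢j ∘ sym) e∈ⱼ e∈ᵢ)) (shared-edge-colour i≢j e∈ᵢ e∈ⱼ))

theorem3p1 : (n m : ℕ) → n ≥ 2 → (G : Multigraph n m) → Connected G
    → (col : Fin m → Fin (n ∸ 1))
    → (Σ (Fin (n ∸ 1) → Fin n) λ center →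
         Injective _≡_ _≡_ center
         × (∀ k → IsSpanningStar G (λ e → col e ≡ k) (center k)))
    → Σ (Fin (n ∸ 1) → Subset m) λ S →
        (∀ i → SpanningStar G (λ e → e ∈ S i))
        × (∀ i → Rainbow G col (λ e → e ∈ S i))
        × (∀ i j → i ≢ j → ∀ e → e ∈ S i → e ∉ S j)
theorem3p1 zero    m () _ _ _ _
theorem3p1 (suc c) m _  G _ col (center , center-injective , stars) =
  rainbowStar , (λ i → center i , rainbowStar-isSpanningStar i) , rainbowStar-rainbow , rainbowStars-disjoint
  where open StarColouring G col center center-injective stars
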